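{- Let $j\ge 5$ and let $\mathcal{E}$ be an Erdős $j$-configuration. (1) Every set of $w$ triangles of $\mathcal{E}$ with $2\le w\le j-3$ spans at least $w+3$ vertices. Equivalently, every set of $v$ vertices of $\mathcal{E}$ with $1\le v\le j-4$ touches at least $v+1$ of the triangles in $\mathcal{E}$. (2) Every set of $w$ triangles of $\mathcal{E}$ with $1\le w\le j-2$ spans at least $w+2$ vertices. Equivalently, every set of $v$ vertices of $\mathcal{E}$ with $0\le v\le j-2$ touches at least $v$ of the triangles in $\mathcal{E}$.
   Context: Triangles are regarded as 3-element vertex sets (triples). A $(i,\ell)$-configuration in a set of triples is a subset of $\ell$ triples spanning at most $i$ vertices. For $j\ge 5$, an Erdős $j$-configuration is a set of $j-2$ triangles spanning exactly $j$ vertices and containing no $(i,i-2)$-configuration for any $4\le i<j$ (i.e., it has girth exactly $j$, where the girth is the least $i\ge 4$ admitting an $(i,i-2)$-configuration). A set of vertices touches a triangle if it contains at least one vertex of that triangle. -}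

module Defs where

open import Data.Nat using (ℕ; zero; suc; _+_; _∸_; _≤_; _<_; _≡ᵇ_)
open import Data.Bool using (Bool; true; false; not; if_then_else_)
open import Data.Fin using (Fin; zero; suc)
open import Data.Fin.Subset using (Subset; ⊥; _∪_; _∩_; _⊆_; ∣_∣)
open import Data.Vec using (Vec; []; _∷_; tabulate)
open import Data.Product using (Σ; _×_; _,_)
open import Function.Definitions using (Injective)
open import Relation.Binary.PropositionalEquality using (_≡_)
open import Relation.Nullary using (¬_)

IsTriangle : {n : ℕ} → Subset n → Set
IsTriangle t = ∣ t ∣ ≡ 3

record TripleSystem (n m : ℕ) : Set where
  field
    tri      : Fin m → Subset n
    isTri    : (i : Fin m) → IsTriangle (tri i)
    distinct : Injective _≡_ _≡_ tri
open TripleSystem public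

spanFam : {n m : ℕ} → (Fin m → Subset n) → Subset m → Subset n
spanFam {m = zero}  T []      = ⊥
spanFam {m = suc m} T (b ∷ S) =
  (if b then T zero else ⊥) ∪ spanFam (λ i → T (suc i)) S

span : {n m : ℕ} → TripleSystem n m → Subset m → Subset n
span E S = spanFam (tri E) S

vertices : {n m : ℕ} → TripleSystem n m → Subset n
vertices {m = m} E = span E (Data.Fin.Subset.⊤)

touched : {n m : ℕ} → TripleSystem n m → Subset n → Subset m
touched E X = tabulate (λ i → not (∣ X ∩ tri E i ∣ ≡ᵇ 0))

IsConfig : {n m : ℕ} → TripleSystem n m → ℕ → ℕ → Subset m → Set
IsConfig E i ℓ S = (∣ S ∣ ≡ ℓ) × (∣ span E S ∣ ≤ i)

IsErdos : {n m : ℕ} → ℕ → TripleSystem n m → Set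
IsErdos {m = m} j E =
  (m ≡ j ∸ 2) × (∣ vertices E ∣ ≡ j) ×
  ((i : ℕ) → 4 ≤ i → i < j → (S : Subset m) → ¬ IsConfig E i (i ∸ 2) S)

-- A set of w triangles spanning at most w + 2 vertices is a (w + 2, w)-configuration, so
-- girth at least j gives |span S| ≥ |S| + 3 whenever 2 ≤ |S| ≤ j - 3; the remaining sizes
-- |S| = 1 (one triangle) and |S| = j - 2 (all of E, spanning j vertices) give |S| + 2.
-- For a vertex set X, the triangles T not touched by X span vertices avoiding X, so
-- |span T| + |X| ≤ j, while |T| = (j - 2) - |touched X|. Feeding the bounds on |span T|
-- into this inequality yields the bounds on |touched X|.
module Submission where

open import Defs
open import Data.Nat using (ℕ; _+_; _∸_; _≤_)
open import Data.Fin.Subset using (Subset; _⊆_; ∣_∣)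
open import Data.Product using (_×_)

open import Data.Nat using (suc; z≤n; s≤s; s≤s⁻¹; _<_; _≤?_; _<?_; _≡ᵇ_)
open import Data.Nat.Properties
open import Data.Bool using (true; false; not)
open import Data.Fin using (Fin; zero; suc)
open import Data.Fin.Subset using (_∈_; ⊤; ⊥; ∁; _∩_; _∪_; Nonempty; Empty)
open import Data.Fin.Subset.Properties
open import Data.Vec using ([]; _∷_; here; there)
open import Data.Vec.Properties using (lookup⇒[]=; lookup∘tabulate)
open import Data.Product using (∃-syntax; _,_)
open import Data.Sum using (inj₁; inj₂; [_,_])
open import Function using (_∘_)
open import Relation.Nullary using (¬_; yes; no; contradiction)
open import Relation.Binary.PropositionalEquality
  using (_≡_; refl; sym; trans; cong; subst; module ≡-Reasoning)

∣p∪q∣+∣p∩q∣≡∣p∣+∣q∣ : ∀ {k} (p q : Subset k) → ∣ p ∪ q ∣ + ∣ p ∩ q ∣ ≡ ∣ p ∣ + ∣ q ∣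
∣p∪q∣+∣p∩q∣≡∣p∣+∣q∣ []         []          = refl
∣p∪q∣+∣p∩q∣≡∣p∣+∣q∣ (true ∷ p) (true ∷ q)  = cong suc (begin
  ∣ p ∪ q ∣ + suc ∣ p ∩ q ∣  ≡⟨ +-suc ∣ p ∪ q ∣ ∣ p ∩ q ∣ ⟩
  suc (∣ p ∪ q ∣ + ∣ p ∩ q ∣) ≡⟨ cong suc (∣p∪q∣+∣p∩q∣≡∣p∣+∣q∣ p q) ⟩
  suc (∣ p ∣ + ∣ q ∣)         ≡⟨ +-suc ∣ p ∣ ∣ q ∣ ⟨
  ∣ p ∣ + suc ∣ q ∣           ∎)
  where open ≡-Reasoning
∣p∪q∣+∣p∩q∣≡∣p∣+∣q∣ (true ∷ p)  (false ∷ q) = cong suc (∣p∪q∣+∣p∩q∣≡∣p∣+∣q∣ p q)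
∣p∪q∣+∣p∩q∣≡∣p∣+∣q∣ (false ∷ p) (true ∷ q)  =
  trans (cong suc (∣p∪q∣+∣p∩q∣≡∣p∣+∣q∣ p q)) (sym (+-suc ∣ p ∣ ∣ q ∣))
∣p∪q∣+∣p∩q∣≡∣p∣+∣q∣ (false ∷ p) (false ∷ q) = ∣p∪q∣+∣p∩q∣≡∣p∣+∣q∣ p q

Empty[p∩q]⇒∣p∣+∣q∣≤∣r∣ : ∀ {k} {p q r : Subset k} → p ⊆ r → q ⊆ r → Empty (p ∩ q) → ∣ p ∣ + ∣ q ∣ ≤ ∣ r ∣
Empty[p∩q]⇒∣p∣+∣q∣≤∣r∣ {k} {p} {q} {r} p⊆r q⊆r disjoint = begin
  ∣ p ∣ + ∣ q ∣             ≡⟨ ∣p∪q∣+∣p∩q∣≡∣p∣+∣q∣ p q ⟨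
  ∣ p ∪ q ∣ + ∣ p ∩ q ∣     ≡⟨ cong (λ s → ∣ p ∪ q ∣ + ∣ s ∣) (Empty-unique disjoint) ⟩
  ∣ p ∪ q ∣ + ∣ ⊥ {k} ∣     ≡⟨ cong (∣ p ∪ q ∣ +_) (∣⊥∣≡0 k) ⟩
  ∣ p ∪ q ∣ + 0             ≡⟨ +-identityʳ ∣ p ∪ q ∣ ⟩
  ∣ p ∪ q ∣                 ≤⟨ p⊆q⇒∣p∣≤∣q∣ (λ x∈ → [ p⊆r , q⊆r ] (x∈p∪q⁻ p q x∈)) ⟩
  ∣ r ∣                     ∎
  where open ≤-Reasoning

∣∁p∣+∣p∣≡n : ∀ {k} (p : Subset k) → ∣ ∁ p ∣ + ∣ p ∣ ≡ k
∣∁p∣+∣p∣≡n p = trans (cong (_+ ∣ p ∣) (∣∁p∣≡n∸∣p∣ p)) (m∸n+n≡m (∣p∣≤n p))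

Nonempty⇒∣p∣>0 : ∀ {k} {p : Subset k} → Nonempty p → 0 < ∣ p ∣
Nonempty⇒∣p∣>0 (_ , x∈p) = ≤-<-trans z≤n (x∈p⇒∣p-x∣<∣p∣ x∈p)

∣p∣>0⇒Nonempty : ∀ {k} {p : Subset k} → 0 < ∣ p ∣ → Nonempty p
∣p∣>0⇒Nonempty {k} {p} ∣p∣>0 with nonempty? p
... | yes nonempty = nonempty
... | no  empty    =
  contradiction (subst (0 <_) (∣⊥∣≡0 k) (subst (λ s → 0 < ∣ s ∣) (Empty-unique empty) ∣p∣>0)) n≮0

m>0⇒m≤o∸n⇒m+n≤o : ∀ {m n o} → 0 < m → m ≤ o ∸ n → m + n ≤ o
m>0⇒m≤o∸n⇒m+n≤o {m} {n} {o} m>0 m≤o∸n = m≤o∸n⇒m+n≤o m n≤o m≤o∸n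
  where
  n≤o : n ≤ o
  n≤o = <⇒≤ (m∸n≢0⇒n<m (λ o∸n≡0 → n≮0 (subst (0 <_) o∸n≡0 (<-≤-trans m>0 m≤o∸n))))

module _ {n : ℕ} where

  x∈spanFam⁺ : ∀ {m} (T : Fin m → Subset n) (S : Subset m) {i x} →
               i ∈ S → x ∈ T i → x ∈ spanFam T S
  x∈spanFam⁺ T (true ∷ S) here         x∈Tᵢ = x∈p∪q⁺ (inj₁ x∈Tᵢ)
  x∈spanFam⁺ T (_ ∷ S)    (there i∈S)  x∈Tᵢ = x∈p∪q⁺ (inj₂ (x∈spanFam⁺ (T ∘ suc) S i∈S x∈Tᵢ))

  x∈spanFam⁻ : ∀ {m} (T : Fin m → Subset n) (S : Subset m) {x} →
               x ∈ spanFam T S → ∃[ i ] i ∈ S × x ∈ T i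
  x∈spanFam⁻ T []      x∈ = contradiction x∈ ∉⊥
  x∈spanFam⁻ T (b ∷ S) x∈ with b | x∈p∪q⁻ _ (spanFam (T ∘ suc) S) x∈
  ... | true  | inj₁ x∈T₀ = zero , here , x∈T₀
  ... | false | inj₁ x∈⊥  = contradiction x∈⊥ ∉⊥
  ... | _     | inj₂ x∈rest with x∈spanFam⁻ (T ∘ suc) S x∈rest
  ...   | i , i∈S , x∈Tᵢ = suc i , there i∈S , x∈Tᵢ

module _ {n m : ℕ} (E : TripleSystem n m) where

  span-⊆-vertices : (S : Subset m) → span E S ⊆ vertices E
  span-⊆-vertices S x∈ with x∈spanFam⁻ (tri E) S x∈
  ... | _ , _ , x∈Tᵢ = x∈spanFam⁺ (tri E) ⊤ ∈⊤ x∈Tᵢ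

  i∈S⇒3≤∣span∣ : {S : Subset m} {i : Fin m} → i ∈ S → 3 ≤ ∣ span E S ∣
  i∈S⇒3≤∣span∣ {S} {i} i∈S =
    subst (_≤ ∣ span E S ∣) (isTri E i) (p⊆q⇒∣p∣≤∣q∣ (x∈spanFam⁺ (tri E) S i∈S))

  i∈touched⁺ : {X : Subset n} {i : Fin m} {x : Fin n} →
               x ∈ X → x ∈ tri E i → i ∈ touched E X
  i∈touched⁺ {X} {i} {x} x∈X x∈Tᵢ =
    lookup⇒[]= i _ (trans (lookup∘tabulate _ i) (positive⇒≢ᵇ0 (Nonempty⇒∣p∣>0 (_ , x∈X∩Tᵢ))))
    where
    x∈X∩Tᵢ : x ∈ X ∩ tri E i
    x∈X∩Tᵢ = x∈p∩q⁺ (x∈X , x∈Tᵢ)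
    positive⇒≢ᵇ0 : ∀ {c} → 0 < c → not (c ≡ᵇ 0) ≡ true
    positive⇒≢ᵇ0 (s≤s _) = refl

  touched-nonempty : {X : Subset n} → X ⊆ vertices E → Nonempty X → Nonempty (touched E X)
  touched-nonempty X⊆V (x , x∈X) with x∈spanFam⁻ (tri E) ⊤ (X⊆V x∈X)
  ... | i , _ , x∈Tᵢ = i , i∈touched⁺ x∈X x∈Tᵢ

  ∣span[∁touched]∣+∣X∣≤∣vertices∣ : {X : Subset n} → X ⊆ vertices E →
    ∣ span E (∁ (touched E X)) ∣ + ∣ X ∣ ≤ ∣ vertices E ∣
  ∣span[∁touched]∣+∣X∣≤∣vertices∣ {X} X⊆V =
    Empty[p∩q]⇒∣p∣+∣q∣≤∣r∣ (span-⊆-vertices _) X⊆V disjoint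
    where
    disjoint : Empty (span E (∁ (touched E X)) ∩ X)
    disjoint (x , x∈span∩X) with x∈p∩q⁻ _ _ x∈span∩X
    ... | x∈span , x∈X with x∈spanFam⁻ (tri E) _ x∈span
    ...   | i , i∉touched , x∈Tᵢ = x∈∁p⇒x∉p i∉touched (i∈touched⁺ x∈X x∈Tᵢ)

GirthAtLeast : {n m : ℕ} → ℕ → TripleSystem n m → Set
GirthAtLeast {m = m} j E = (i : ℕ) → 4 ≤ i → i < j → (S : Subset m) → ¬ IsConfig E i (i ∸ 2) S

girth⇒∣S∣+3≤∣span∣ : ∀ {n m j} (E : TripleSystem n m) → GirthAtLeast j E →
  (S : Subset m) → 2 ≤ ∣ S ∣ → ∣ S ∣ ≤ j ∸ 3 → ∣ S ∣ + 3 ≤ ∣ span E S ∣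
girth⇒∣S∣+3≤∣span∣ {j = j} E girth S 2≤∣S∣ ∣S∣≤j∸3 with ∣ span E S ∣ ≤? ∣ S ∣ + 2
... | no  ∣span∣≰ = subst (_≤ ∣ span E S ∣) (sym (+-suc ∣ S ∣ 2)) (≰⇒> ∣span∣≰)
... | yes ∣span∣≤ =
  contradiction (sym (m+n∸n≡m ∣ S ∣ 2) , ∣span∣≤) (girth (∣ S ∣ + 2) (+-monoˡ-≤ 2 2≤∣S∣) ∣S∣+2<j S)
  where
  ∣S∣+2<j : ∣ S ∣ + 2 < j
  ∣S∣+2<j = subst (_≤ j) (+-suc ∣ S ∣ 2) (m>0⇒m≤o∸n⇒m+n≤o (≤-trans (s≤s z≤n) 2≤∣S∣) ∣S∣≤j∸3)

module Erdős {n m : ℕ} (E : TripleSystem n m) (girth : GirthAtLeast (2 + m) E)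
             (∣vertices∣≡2+m : ∣ vertices E ∣ ≡ 2 + m) where

  ∣S∣+2≤∣span∣ : (S : Subset m) → 1 ≤ ∣ S ∣ → ∣ S ∣ ≤ m → ∣ S ∣ + 2 ≤ ∣ span E S ∣
  ∣S∣+2≤∣span∣ S 1≤∣S∣ ∣S∣≤m with 2 ≤? ∣ S ∣ | ∣ S ∣ <? m
  ... | no ∣S∣≱2 | _ with ∣p∣>0⇒Nonempty 1≤∣S∣
  ...   | _ , i∈S = subst (λ s → s + 2 ≤ ∣ span E S ∣) (sym ∣S∣≡1) (i∈S⇒3≤∣span∣ E i∈S)
    where
    ∣S∣≡1 : ∣ S ∣ ≡ 1
    ∣S∣≡1 = ≤-antisym (s≤s⁻¹ (≰⇒> ∣S∣≱2)) 1≤∣S∣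
  ∣S∣+2≤∣span∣ S _ _ | yes 2≤∣S∣ | yes ∣S∣<m =
    ≤-trans (+-monoʳ-≤ ∣ S ∣ (n≤1+n 2))
      (girth⇒∣S∣+3≤∣span∣ E girth S 2≤∣S∣ (m+n≤o⇒m≤o∸n ∣ S ∣ (subst (_≤ m) (+-comm 1 ∣ S ∣) ∣S∣<m)))
  ∣S∣+2≤∣span∣ S _ ∣S∣≤m | yes _ | no ∣S∣≮m = ≤-reflexive (begin
    ∣ S ∣ + 2          ≡⟨ cong (_+ 2) ∣S∣≡m ⟩
    m + 2              ≡⟨ +-comm m 2 ⟩
    2 + m              ≡⟨ ∣vertices∣≡2+m ⟨
    ∣ vertices E ∣     ≡⟨ cong (∣_∣ ∘ span E) (∣p∣≡n⇒p≡⊤ ∣S∣≡m) ⟨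
    ∣ span E S ∣       ∎)
    where
    open ≡-Reasoning
    ∣S∣≡m : ∣ S ∣ ≡ m
    ∣S∣≡m = ≤-antisym ∣S∣≤m (≮⇒≥ ∣S∣≮m)

  c+∣X∣≤2+∣touched∣ : {X : Subset n} → X ⊆ vertices E → (c : ℕ) →
    ∣ ∁ (touched E X) ∣ + c ≤ ∣ span E (∁ (touched E X)) ∣ → c + ∣ X ∣ ≤ 2 + ∣ touched E X ∣
  c+∣X∣≤2+∣touched∣ {X} X⊆V c ∣T∣+c≤∣span∣ = +-cancelˡ-≤ a _ _ (begin
    a + (c + ∣ X ∣)              ≡⟨ +-assoc a c ∣ X ∣ ⟨
    a + c + ∣ X ∣                ≤⟨ +-monoˡ-≤ ∣ X ∣ ∣T∣+c≤∣span∣ ⟩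
    ∣ span E (∁ T) ∣ + ∣ X ∣     ≤⟨ ∣span[∁touched]∣+∣X∣≤∣vertices∣ E X⊆V ⟩
    ∣ vertices E ∣               ≡⟨ ∣vertices∣≡2+m ⟩
    2 + m                        ≡⟨ cong (2 +_) (∣∁p∣+∣p∣≡n T) ⟨
    2 + (a + t)                  ≡⟨ +-assoc 2 a t ⟨
    2 + a + t                    ≡⟨ cong (_+ t) (+-comm 2 a) ⟩
    a + 2 + t                    ≡⟨ +-assoc a 2 t ⟩
    a + (2 + t)                  ∎)
    where
    open ≤-Reasoning
    T : Subset m
    T = touched E X
    a t : ℕ
    a = ∣ ∁ T ∣
    t = ∣ T ∣

  ∣X∣≤∣touched∣ : (X : Subset n) → X ⊆ vertices E → ∣ X ∣ ≤ m → ∣ X ∣ ≤ ∣ touched E X ∣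
  ∣X∣≤∣touched∣ X X⊆V ∣X∣≤m with 1 ≤? ∣ ∁ (touched E X) ∣
  ... | yes 1≤∣∁T∣ =
    s≤s⁻¹ (s≤s⁻¹ (c+∣X∣≤2+∣touched∣ X⊆V 2 (∣S∣+2≤∣span∣ _ 1≤∣∁T∣ (∣p∣≤n (∁ (touched E X))))))
  ... | no  ∣∁T∣≱1 = begin
    ∣ X ∣                                      ≤⟨ ∣X∣≤m ⟩
    m                                          ≡⟨ ∣∁p∣+∣p∣≡n (touched E X) ⟨
    ∣ ∁ (touched E X) ∣ + ∣ touched E X ∣      ≡⟨ cong (_+ ∣ touched E X ∣) (n≤0⇒n≡0 (≮⇒≥ ∣∁T∣≱1)) ⟩
    ∣ touched E X ∣                            ∎
    where open ≤-Reasoning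

  ∣X∣+1≤∣touched∣ : (X : Subset n) → X ⊆ vertices E → 1 ≤ ∣ X ∣ → ∣ X ∣ ≤ m ∸ 2 →
    ∣ X ∣ + 1 ≤ ∣ touched E X ∣
  ∣X∣+1≤∣touched∣ X X⊆V 1≤∣X∣ ∣X∣≤m∸2 with 2 ≤? ∣ ∁ (touched E X) ∣
  ... | yes 2≤∣∁T∣ = subst (_≤ ∣ touched E X ∣) (+-comm 1 ∣ X ∣)
    (s≤s⁻¹ (s≤s⁻¹ (c+∣X∣≤2+∣touched∣ X⊆V 3 (girth⇒∣S∣+3≤∣span∣ E girth _ 2≤∣∁T∣ ∣∁T∣≤m∸1))))
    where
    open ≤-Reasoning
    ∣∁T∣≤m∸1 : ∣ ∁ (touched E X) ∣ ≤ m ∸ 1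
    ∣∁T∣≤m∸1 = m+n≤o⇒m≤o∸n _ (begin
      ∣ ∁ (touched E X) ∣ + 1                  ≤⟨ +-monoʳ-≤ _ (Nonempty⇒∣p∣>0
                                                    (touched-nonempty E X⊆V (∣p∣>0⇒Nonempty 1≤∣X∣))) ⟩
      ∣ ∁ (touched E X) ∣ + ∣ touched E X ∣    ≡⟨ ∣∁p∣+∣p∣≡n (touched E X) ⟩
      m                                        ∎)
  ... | no  ∣∁T∣≱2 = s≤s⁻¹ (begin
    suc (∣ X ∣ + 1)                            ≡⟨ +-suc ∣ X ∣ 1 ⟨
    ∣ X ∣ + 2                                  ≤⟨ m>0⇒m≤o∸n⇒m+n≤o 1≤∣X∣ ∣X∣≤m∸2 ⟩
    m                                          ≡⟨ ∣∁p∣+∣p∣≡n (touched E X) ⟨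
    ∣ ∁ (touched E X) ∣ + ∣ touched E X ∣      ≤⟨ +-monoˡ-≤ _ (s≤s⁻¹ (≰⇒> ∣∁T∣≱2)) ⟩
    suc ∣ touched E X ∣                        ∎)
    where open ≤-Reasoning

lemma3p2 : (j n m : ℕ) → 5 ≤ j → (E : TripleSystem n m) → IsErdos j E →
    (((S : Subset m) → 2 ≤ ∣ S ∣ → ∣ S ∣ ≤ j ∸ 3 → ∣ S ∣ + 3 ≤ ∣ span E S ∣)
     × ((X : Subset n) → X ⊆ vertices E → 1 ≤ ∣ X ∣ → ∣ X ∣ ≤ j ∸ 4 →
          ∣ X ∣ + 1 ≤ ∣ touched E X ∣))
    × (((S : Subset m) → 1 ≤ ∣ S ∣ → ∣ S ∣ ≤ j ∸ 2 → ∣ S ∣ + 2 ≤ ∣ span E S ∣)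
     × ((X : Subset n) → X ⊆ vertices E → ∣ X ∣ ≤ j ∸ 2 →
          ∣ X ∣ ≤ ∣ touched E X ∣))
lemma3p2 (suc (suc m)) n .m (s≤s (s≤s _)) E (refl , ∣vertices∣≡2+m , girth) =
  (girth⇒∣S∣+3≤∣span∣ E girth , ∣X∣+1≤∣touched∣) , (∣S∣+2≤∣span∣ , ∣X∣≤∣touched∣)
  where open Erdős E girth ∣vertices∣≡2+m
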